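{- Let $T:\mathcal V\text{ -cat}\to\mathcal V\text{ -cat}$ be a 2-functor that preserves exact squares. Define $\overline T(\mathcal A)=T\mathcal A$ on objects and, for a module $R:\mathcal A\rightsquigarrow\mathcal B$ with collage $(i_0,\mathrm{Coll}(R),i_1)$, put $\overline T(R)=(Ti_0)^\diamond\cdot(Ti_1)_\diamond:T\mathcal A\rightsquigarrow T\mathcal B$. Then this assignment extends to a 2-functor $\overline T:\mathcal V\text{ -mod}\to\mathcal V\text{ -mod}$ such that $\overline T\circ(-)_\diamond=(-)_\diamond\circ T$.
   Context: $\mathcal V=(\mathcal V_o,\otimes,I,[-,-])$ is a commutative quantale: $\mathcal V_o$ a complete lattice (least element $\bot$), $\otimes$ commutative associative with unit $I$ preserving joins in each variable, $x\otimes y\le z$ iff $y\le[x,z]$. $\mathcal V$-categories have hom-values $\mathcal A(a,b)\in\mathcal V_o$ with $I\le\mathcal A(a,a)$, $\mathcal A(b,c)\otimes\mathcal A(a,b)\le\mathcal A(a,c)$; $\mathcal V$-functors satisfy $\mathcal A(a,a')\le\mathcal B(fa,fa')$; $f\le g$ iff $I\le\mathcal B(fa,ga)$ for all $a$. $\mathcal V\text{ -cat}$: 2-category of small $\mathcal V$-categories, $\mathcal V$-functors and $\le$; a 2-functor on it is a functor preserving $\le$. A module $R:\mathcal A\rightsquigarrow\mathcal B$ is a $\mathcal V$-functor $\mathcal B^{op}\otimes\mathcal A\to\mathcal V$; composition $(S\cdot R)(c,a)=\bigvee_bS(c,b)\otimes R(b,a)$, identities hom-functors, pointwise order: the 2-category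 $\mathcal V\text{ -mod}$. For $f:\mathcal A\to\mathcal B$: $f_\diamond:\mathcal A\rightsquigarrow\mathcal B$, $f_\diamond(b,a)=\mathcal B(b,fa)$; $f^\diamond:\mathcal B\rightsquigarrow\mathcal A$, $f^\diamond(a,b)=\mathcal B(fa,b)$; $(-)_\diamond:\mathcal V\text{ -cat}\to\mathcal V\text{ -mod}$ is identity on objects. Collage of $R:\mathcal A\rightsquigarrow\mathcal B$: objects the disjoint union of those of $\mathcal A,\mathcal B$, homs $\mathcal A(a,a')$, $\mathcal B(b,b')$, $\mathrm{Coll}(R)(b,a)=R(b,a)$, $\mathrm{Coll}(R)(a,b)=\bot$, inclusions $i_0:\mathcal B\to\mathrm{Coll}(R)$, $i_1:\mathcal A\to\mathrm{Coll}(R)$. A lax square consists of $p_0:\mathcal P\to\mathcal A$, $p_1:\mathcal P\to\mathcal B$, $f:\mathcal A\to\mathcal C$, $g:\mathcal B\to\mathcal C$ with $fp_0\le gp_1$; it is exact if $\mathcal C(fa,gb)=\bigvee_{w}\mathcal A(a,p_0w)\otimes\mathcal B(p_1w,b)$ for all $a\in\mathcal A$, $b\in\mathcal B$. $T$ preserves exact squares if it sends every exact lax square to an exact lax square. -}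

module Defs where

open import Data.Empty renaming (⊥ to Empty)
open import Data.Sum using (_⊎_; inj₁; inj₂)
open import Data.Product using (_×_; _,_)
open import Relation.Binary.PropositionalEquality
  using (_≡_; refl; sym; trans; cong; subst; module ≡-Reasoning)

record Quantale : Set₁ where
  infix 4 _≤_
  infixr 7 _⊗_
  field
    Carrier   : Set
    _≤_       : Carrier → Carrier → Set
    ≤-refl    : ∀ {x} → x ≤ x
    ≤-trans   : ∀ {x y z} → x ≤ y → y ≤ z → x ≤ z
    ≤-antisym : ∀ {x y} → x ≤ y → y ≤ x → x ≡ y
    ⋁         : {J : Set} → (J → Carrier) → Carrier
    ⋁-ub      : ∀ {J} (f : J → Carrier) (j : J) → f j ≤ ⋁ f
    ⋁-lub     : ∀ {J} (f : J → Carrier) (x : Carrier) → (∀ j → f j ≤ x) → ⋁ f ≤ x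
    _⊗_       : Carrier → Carrier → Carrier
    I         : Carrier
    ⊗-assoc   : ∀ x y z → (x ⊗ y) ⊗ z ≡ x ⊗ (y ⊗ z)
    ⊗-comm    : ∀ x y → x ⊗ y ≡ y ⊗ x
    ⊗-identityˡ : ∀ x → I ⊗ x ≡ x
    -- ⊗ preserves joins in each variable (the other variable by commutativity)
    ⊗-⋁       : ∀ x {J} (f : J → Carrier) → x ⊗ ⋁ f ≡ ⋁ (λ j → x ⊗ f j)
    [_,_]     : Carrier → Carrier → Carrier
    adj-to    : ∀ {x y z} → x ⊗ y ≤ z → y ≤ [ x , z ]
    adj-from  : ∀ {x y z} → y ≤ [ x , z ] → x ⊗ y ≤ z

module Theory (Q : Quantale) where
  open Quantale Q public

  bot : Carrier
  bot = ⋁ {Empty} ⊥-elim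

  bot-least : ∀ {x} → bot ≤ x
  bot-least {x} = ⋁-lub ⊥-elim x (λ ())

  ≤-reflexive : ∀ {x y} → x ≡ y → x ≤ y
  ≤-reflexive refl = ≤-refl

  ⊗-monoʳ : ∀ {x y y'} → y ≤ y' → x ⊗ y ≤ x ⊗ y'
  ⊗-monoʳ p = adj-from (≤-trans p (adj-to ≤-refl))

  ⊗-monoˡ : ∀ {x x' y} → x ≤ x' → x ⊗ y ≤ x' ⊗ y
  ⊗-monoˡ {x} {x'} {y} p rewrite ⊗-comm x y | ⊗-comm x' y = ⊗-monoʳ p

  ⊗-botʳ : ∀ {x z} → x ⊗ bot ≤ z
  ⊗-botʳ = adj-from bot-least

  ⊗-botˡ : ∀ {x z} → bot ⊗ x ≤ z
  ⊗-botˡ {x} rewrite ⊗-comm bot x = ⊗-botʳ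

  ⊗⋁-le : ∀ x {J} (f : J → Carrier) z → (∀ j → x ⊗ f j ≤ z) → x ⊗ ⋁ f ≤ z
  ⊗⋁-le x f z h = subst (_≤ z) (sym (⊗-⋁ x f)) (⋁-lub _ z h)

  record VCat : Set₁ where
    field
      Obj      : Set
      hom      : Obj → Obj → Carrier
      hom-id   : ∀ a → I ≤ hom a a
      hom-comp : ∀ a b c → hom b c ⊗ hom a b ≤ hom a c
  open VCat public

  record Fun (A B : VCat) : Set where
    field
      map      : Obj A → Obj B
      map-mono : ∀ a a' → hom A a a' ≤ hom B (map a) (map a')
  open Fun public

  idF : (A : VCat) → Fun A A
  idF A = record { map = λ a → a ; map-mono = λ _ _ → ≤-refl }

  _∘F_ : ∀ {A B C} → Fun B C → Fun A B → Fun A C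
  g ∘F f = record { map = λ a → map g (map f a)
                  ; map-mono = λ a a' → ≤-trans (map-mono f a a') (map-mono g _ _) }

  _≈F_ : ∀ {A B} → Fun A B → Fun A B → Set
  f ≈F g = ∀ a → map f a ≡ map g a

  _≤F_ : ∀ {A B} → Fun A B → Fun A B → Set
  _≤F_ {B = B} f g = ∀ a → I ≤ hom B (map f a) (map g a)

  record TwoFunctor : Set₁ where
    field
      obj    : VCat → VCat
      fmap   : ∀ {A B} → Fun A B → Fun (obj A) (obj B)
      fmap-resp : ∀ {A B} {f g : Fun A B} → f ≈F g → fmap f ≈F fmap g
      fmap-id   : ∀ {A} → fmap (idF A) ≈F idF (obj A)
      fmap-comp : ∀ {A B C} (f : Fun A B) (g : Fun B C) → fmap (g ∘F f) ≈F (fmap g ∘F fmap f)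
      fmap-mono : ∀ {A B} {f g : Fun A B} → f ≤F g → fmap f ≤F fmap g
  open TwoFunctor public

  Lax : ∀ {P A B C} → Fun P A → Fun P B → Fun A C → Fun B C → Set
  Lax p₀ p₁ f g = (f ∘F p₀) ≤F (g ∘F p₁)

  Exact : ∀ {P A B C} → Fun P A → Fun P B → Fun A C → Fun B C → Set
  Exact {P} {A} {B} {C} p₀ p₁ f g =
    ∀ a b → hom C (map f a) (map g b)
            ≡ ⋁ {Obj P} (λ w → hom A a (map p₀ w) ⊗ hom B (map p₁ w) b)

  PreservesExact : TwoFunctor → Set₁
  PreservesExact T =
    ∀ {P A B C} (p₀ : Fun P A) (p₁ : Fun P B) (f : Fun A C) (g : Fun B C) →
      Lax p₀ p₁ f g → Exact p₀ p₁ f g →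
      Lax (fmap T p₀) (fmap T p₁) (fmap T f) (fmap T g)
        × Exact (fmap T p₀) (fmap T p₁) (fmap T f) (fmap T g)

  RawMod : VCat → VCat → Set
  RawMod A B = Obj B → Obj A → Carrier

  -- V-functoriality of R : B^op ⊗ A → V, i.e. left B-action and right A-action
  record IsModule (A B : VCat) (R : RawMod A B) : Set where
    field
      act-l : ∀ b b' a → R b' a ⊗ hom B b b' ≤ R b a
      act-r : ∀ b a a' → hom A a a' ⊗ R b a ≤ R b a'
  open IsModule public

  record Module (A B : VCat) : Set where
    field
      R     : RawMod A B
      isMod : IsModule A B R
  open Module public

  -- composition (S · R)(c,a) = ⋁_b S(c,b) ⊗ R(b,a)
  -- all three V-categories are explicit, since they cannot be inferred
  compRaw : (A B C : VCat) → RawMod B C → RawMod A B → RawMod A C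
  compRaw A B C S R c a = ⋁ {Obj B} (λ b → S c b ⊗ R b a)

  lower : ∀ {A B} → Fun A B → RawMod A B
  lower {B = B} f b a = hom B b (map f a)

  upper : ∀ {A B} → Fun A B → RawMod B A
  upper {B = B} f a b = hom B (map f a) b

  idMod : (A : VCat) → Module A A
  idMod A = record { R = hom A
                   ; isMod = record { act-l = λ b b' a → hom-comp A b b' a
                                    ; act-r = λ b a a' → hom-comp A b a a' } }

  lowerMod : ∀ {A B} → Fun A B → Module A B
  lowerMod {A} {B} f = record
    { R = lower f
    ; isMod = record
      { act-l = λ b b' a → hom-comp B b b' (map f a)
      ; act-r = λ b a a' → ≤-trans (⊗-monoˡ (map-mono f a a')) (hom-comp B b (map f a) (map f a')) } }

  private
    rearr : ∀ x y z → x ⊗ (y ⊗ z) ≡ y ⊗ (x ⊗ z)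
    rearr x y z = trans (sym (⊗-assoc x y z)) (trans (cong (_⊗ z) (⊗-comm x y)) (⊗-assoc y x z))

  compMod : ∀ {A B C} → Module B C → Module A B → Module A C
  compMod {A} {B} {C} S R = record
    { R = compRaw A B C (Module.R S) (Module.R R)
    ; isMod = record
      { act-l = λ c c' a →
          subst (_≤ (compRaw A B C (Module.R S) (Module.R R) c a)) (⊗-comm _ _)
            (⊗⋁-le (hom C c c') _ _ λ b →
              ≤-trans (≤-reflexive (sym (⊗-assoc _ _ _)))
                (≤-trans (⊗-monoˡ (subst (_≤ _) (⊗-comm _ _) (act-l (isMod S) c c' b)))
                  (⋁-ub (λ b → Module.R S c b ⊗ Module.R R b a) b)))
      ; act-r = λ c a a' →
          ⊗⋁-le (hom A a a') _ _ λ b →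
            ≤-trans (≤-reflexive (rearr _ _ _))
              (≤-trans (⊗-monoʳ (act-r (isMod R) b a a'))
                (⋁-ub (λ b → Module.R S c b ⊗ Module.R R b a') b)) } }

  Coll : ∀ {A B} → Module A B → VCat
  Coll {A} {B} M = record { Obj = Obj B ⊎ Obj A ; hom = h ; hom-id = hid ; hom-comp = hc }
    where
      h : Obj B ⊎ Obj A → Obj B ⊎ Obj A → Carrier
      h (inj₁ b) (inj₁ b') = hom B b b'
      h (inj₁ b) (inj₂ a)  = Module.R M b a
      h (inj₂ a) (inj₁ b)  = bot
      h (inj₂ a) (inj₂ a') = hom A a a'
      hid : ∀ x → I ≤ h x x
      hid (inj₁ b) = hom-id B b
      hid (inj₂ a) = hom-id A a
      hc : ∀ x y z → h y z ⊗ h x y ≤ h x z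
      hc (inj₁ b) (inj₁ b') (inj₁ b'') = hom-comp B b b' b''
      hc (inj₁ b) (inj₁ b') (inj₂ a)   = act-l (isMod M) b b' a
      hc (inj₁ b) (inj₂ a)  (inj₁ b')  = ⊗-botˡ
      hc (inj₁ b) (inj₂ a)  (inj₂ a')  = act-r (isMod M) b a a'
      hc (inj₂ a) (inj₁ b)  z          = ⊗-botʳ
      hc (inj₂ a) (inj₂ a') (inj₁ b)   = ⊗-botˡ
      hc (inj₂ a) (inj₂ a') (inj₂ a'') = hom-comp A a a' a''

  i₀ : ∀ {A B} (M : Module A B) → Fun B (Coll M)
  i₀ M = record { map = inj₁ ; map-mono = λ _ _ → ≤-refl }

  i₁ : ∀ {A B} (M : Module A B) → Fun A (Coll M)
  i₁ M = record { map = inj₂ ; map-mono = λ _ _ → ≤-refl }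

  Tbar : (T : TwoFunctor) → ∀ {A B} → Module A B → RawMod (obj T A) (obj T B)
  Tbar T {A} {B} M = compRaw (obj T A) (obj T (Coll M)) (obj T B) (upper (fmap T (i₀ M))) (lower (fmap T (i₁ M)))

-- T̄(R)(c, x) is the hom of T(Coll R) between the images of c and x, so it is a
-- module, and monotone in R through the identity-on-objects functor Coll R → Coll R'.
-- Identities and f_⋄ come from the exact square saying that f_⋄ is represented by
-- the span (f, id) into Coll(f_⋄). For composition, glue Coll N and Coll M along B
-- into one three-layer collage: the square over B is exact (this is N · M), the
-- collage of N · M sits in it fully faithfully, and T preserves both facts.
module Submission where

open import Defs
open import Data.Product using (_×_; _,_; proj₂)
open import Data.Sum using (_⊎_; inj₁; inj₂)
import Data.Sum as Sum
open import Relation.Binary.PropositionalEquality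
  using (_≡_; refl; sym; trans; cong; cong₂; module ≡-Reasoning)

module _ (Q : Quantale) where
  open Theory Q
  open ≡-Reasoning

  ⋁-cong : ∀ {J} {f g : J → Carrier} → (∀ j → f j ≡ g j) → ⋁ f ≡ ⋁ g
  ⋁-cong {f = f} {g} f≡g = ≤-antisym
    (⋁-lub f (⋁ g) λ j → ≤-trans (≤-reflexive (f≡g j)) (⋁-ub g j))
    (⋁-lub g (⋁ f) λ j → ≤-trans (≤-reflexive (sym (f≡g j))) (⋁-ub f j))

  y≤x⊗y : ∀ {x y} → I ≤ x → y ≤ x ⊗ y
  y≤x⊗y {x} {y} I≤x = ≤-trans (≤-reflexive (sym (⊗-identityˡ y))) (⊗-monoˡ I≤x)

  x≤x⊗y : ∀ {x y} → I ≤ y → x ≤ x ⊗ y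
  x≤x⊗y {x} {y} I≤y = ≤-trans (y≤x⊗y I≤y) (≤-reflexive (⊗-comm y x))

  compRaw-identityʳ : ∀ {X Y} (N : Module X Y) y x →
    compRaw X X Y (R N) (hom X) y x ≡ R N y x
  compRaw-identityʳ {X} N y x = ≤-antisym
    (⋁-lub _ _ λ x' → ≤-trans (≤-reflexive (⊗-comm _ _)) (act-r (isMod N) y x' x))
    (≤-trans (x≤x⊗y (hom-id X x)) (⋁-ub (λ x' → R N y x' ⊗ hom X x' x) x))

  compRaw-identityˡ : ∀ {X Y} (M : Module X Y) y x →
    compRaw X Y Y (hom Y) (R M) y x ≡ R M y x
  compRaw-identityˡ {Y = Y} M y x = ≤-antisym
    (⋁-lub _ _ λ y' → ≤-trans (≤-reflexive (⊗-comm _ _)) (act-l (isMod M) y y' x))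
    (≤-trans (y≤x⊗y (hom-id Y y)) (⋁-ub (λ y' → hom Y y y' ⊗ R M y' x) y))

  upperMod : ∀ {A B} → Fun A B → Module B A
  upperMod {A} {B} f = record
    { R = upper f
    ; isMod = record
      { act-l = λ a a' b → ≤-trans (⊗-monoʳ (map-mono f a a')) (hom-comp B (map f a) (map f a') b)
      ; act-r = λ a b b' → hom-comp B (map f a) b b' } }

  FullyFaithful : ∀ {A B} → Fun A B → Set
  FullyFaithful {A} {B} f = ∀ a a' → hom B (map f a) (map f a') ≡ hom A a a'

  collMap : ∀ {A A' B B'} {M : Module A B} {M' : Module A' B'} (g : Fun B B') (f : Fun A A') →
    (∀ b a → R M b a ≤ R M' (map g b) (map f a)) → Fun (Coll M) (Coll M')
  collMap {M = M} {M'} g f M≤M' = record { map = Sum.map (map g) (map f) ; map-mono = mono }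
    where
      mono : ∀ u v → hom (Coll M) u v ≤ hom (Coll M') (Sum.map (map g) (map f) u) (Sum.map (map g) (map f) v)
      mono (inj₁ b) (inj₁ b') = map-mono g b b'
      mono (inj₁ b) (inj₂ a)  = M≤M' b a
      mono (inj₂ a) (inj₁ b)  = ≤-refl
      mono (inj₂ a) (inj₂ a') = map-mono f a a'

  collMap-fullyFaithful : ∀ {A A' B B'} {M : Module A B} {M' : Module A' B'} {g : Fun B B'} {f : Fun A A'} →
    (M≤M' : ∀ b a → R M b a ≤ R M' (map g b) (map f a)) →
    FullyFaithful g → FullyFaithful f → (∀ b a → R M' (map g b) (map f a) ≡ R M b a) →
    FullyFaithful (collMap {M = M} {M'} g f M≤M')
  collMap-fullyFaithful _ g-ff f-ff M'≡M (inj₁ b) (inj₁ b') = g-ff b b'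
  collMap-fullyFaithful _ g-ff f-ff M'≡M (inj₁ b) (inj₂ a)  = M'≡M b a
  collMap-fullyFaithful _ g-ff f-ff M'≡M (inj₂ a) (inj₁ b)  = refl
  collMap-fullyFaithful _ g-ff f-ff M'≡M (inj₂ a) (inj₂ a') = f-ff a a'

  -- Its collage is the three-layer collage of C, B, A, containing Coll N, Coll M and Coll (N · M).
  stackMod : ∀ {A B C} (M : Module A B) (N : Module B C) → Module (Coll M) C
  stackMod {A} {B} {C} M N = record
    { R = L
    ; isMod = record { act-l = left ; act-r = right } }
    where
      L : Obj C → Obj B ⊎ Obj A → Carrier
      L c (inj₁ b) = R N c b
      L c (inj₂ a) = R (compMod N M) c a
      left : ∀ c c' u → L c' u ⊗ hom C c c' ≤ L c u
      left c c' (inj₁ b) = act-l (isMod N) c c' b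
      left c c' (inj₂ a) = act-l (isMod (compMod N M)) c c' a
      right : ∀ c u u' → hom (Coll M) u u' ⊗ L c u ≤ L c u'
      right c (inj₁ b) (inj₁ b') = act-r (isMod N) c b b'
      right c (inj₁ b) (inj₂ a)  =
        ≤-trans (≤-reflexive (⊗-comm _ _)) (⋁-ub (λ b → R N c b ⊗ R M b a) b)
      right c (inj₂ a) (inj₁ b)  = ⊗-botˡ
      right c (inj₂ a) (inj₂ a') = act-r (isMod (compMod N M)) c a a'

  module _ {A B C : VCat} (M : Module A B) (N : Module B C) where

    collN→stack : Fun (Coll N) (Coll (stackMod M N))
    collN→stack = collMap (idF C) (i₀ M) (λ _ _ → ≤-refl)

    collNM→stack : Fun (Coll (compMod N M)) (Coll (stackMod M N))
    collNM→stack = collMap (idF C) (i₁ M) (λ _ _ → ≤-refl)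

    collNM→stack-fullyFaithful : FullyFaithful collNM→stack
    collNM→stack-fullyFaithful =
      collMap-fullyFaithful {M = compMod N M} {stackMod M N} {g = idF C} {f = i₁ M}
        (λ _ _ → ≤-refl) (λ _ _ → refl) (λ _ _ → refl) (λ _ _ → refl)

    stack-lax : Lax (i₁ N) (i₀ M) collN→stack (i₁ (stackMod M N))
    stack-lax = hom-id B

    stack-exact : Exact (i₁ N) (i₀ M) collN→stack (i₁ (stackMod M N))
    stack-exact (inj₁ c) (inj₁ b) = sym (compRaw-identityʳ N c b)
    stack-exact (inj₁ c) (inj₂ a) = refl
    stack-exact (inj₂ b) (inj₁ b') = sym (compRaw-identityʳ (idMod B) b b')
    stack-exact (inj₂ b) (inj₂ a) = sym (compRaw-identityˡ M b a)

  module _ (T : TwoFunctor) where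

    fmap-triangle : ∀ {A B C} {f : Fun A B} {g : Fun B C} {h : Fun A C} → (g ∘F f) ≈F h →
      ∀ a → map (fmap T g) (map (fmap T f) a) ≡ map (fmap T h) a
    fmap-triangle {f = f} {g} gf≈h a = trans (sym (fmap-comp T f g a)) (fmap-resp T gf≈h a)

    fmap-square : ∀ {A B B' C} {f : Fun A B} {g : Fun B C} {f' : Fun A B'} {g' : Fun B' C} →
      (g ∘F f) ≈F (g' ∘F f') →
      ∀ a → map (fmap T g) (map (fmap T f) a) ≡ map (fmap T g') (map (fmap T f') a)
    fmap-square {f' = f'} {g'} sq a = trans (fmap-triangle sq a) (fmap-comp T f' g' a)

    Tbar-isModule : ∀ {A B} (M : Module A B) → IsModule (obj T A) (obj T B) (Tbar T M)
    Tbar-isModule M = isMod (compMod (upperMod (fmap T (i₀ M))) (lowerMod (fmap T (i₁ M))))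

    Tbar-hom : ∀ {A B} (M : Module A B) c x →
      Tbar T M c x ≡ hom (obj T (Coll M)) (map (fmap T (i₀ M)) c) (map (fmap T (i₁ M)) x)
    Tbar-hom M c x = compRaw-identityʳ (idMod (obj T (Coll M))) _ _

    Tbar-mono : ∀ {A B} (M M' : Module A B) → (∀ b a → R M b a ≤ R M' b a) →
      ∀ c x → Tbar T M c x ≤ Tbar T M' c x
    Tbar-mono {A} {B} M M' M≤M' c x =
      ≤-trans (≤-reflexive (Tbar-hom M c x))
        (≤-trans (map-mono (fmap T (collMap (idF B) (idF A) M≤M')) _ _)
          (≤-reflexive (trans (cong₂ (hom (obj T (Coll M')))
                                 (fmap-triangle (λ _ → refl) c) (fmap-triangle (λ _ → refl) x))
                              (sym (Tbar-hom M' c x)))))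

    module _ (pe : PreservesExact T) where

      fmap-fullyFaithful : ∀ {A B} {f : Fun A B} → FullyFaithful f → FullyFaithful (fmap T f)
      fmap-fullyFaithful {A} {B} {f} f-ff a a' = begin
        hom TB (map (fmap T f) a) (map (fmap T f) a')
          ≡⟨ proj₂ (pe (idF A) (idF A) f f (λ a → hom-id B (map f a)) exact) a a' ⟩
        ⋁ (λ w → hom TA a (map (fmap T (idF A)) w) ⊗ hom TA (map (fmap T (idF A)) w) a')
          ≡⟨ ⋁-cong (λ w → cong (λ v → hom TA a v ⊗ hom TA v a') (fmap-id T w)) ⟩
        ⋁ (λ w → hom TA a w ⊗ hom TA w a')
          ≡⟨ compRaw-identityʳ (idMod TA) a a' ⟩
        hom TA a a' ∎
        where
          TA = obj T A
          TB = obj T B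
          exact : Exact (idF A) (idF A) f f
          exact a a' = trans (f-ff a a') (sym (compRaw-identityʳ (idMod A) a a'))

      Tbar-represented : ∀ {A B} (M : Module A B) (p : Fun A B) →
        (∀ b a → R M b a ≡ hom B b (map p a)) →
        ∀ c x → Tbar T M c x ≡ hom (obj T B) c (map (fmap T p) x)
      Tbar-represented {A} {B} M p M≡p c x = begin
        Tbar T M c x
          ≡⟨ Tbar-hom M c x ⟩
        hom (obj T (Coll M)) (map (fmap T (i₀ M)) c) (map (fmap T (i₁ M)) x)
          ≡⟨ proj₂ (pe p (idF A) (i₀ M) (i₁ M) lax exact) c x ⟩
        ⋁ (λ w → hom TB c (map (fmap T p) w) ⊗ hom TA (map (fmap T (idF A)) w) x)
          ≡⟨ ⋁-cong (λ w → cong (λ v → hom TB c (map (fmap T p) w) ⊗ hom TA v x) (fmap-id T w)) ⟩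
        ⋁ (λ w → hom TB c (map (fmap T p) w) ⊗ hom TA w x)
          ≡⟨ compRaw-identityʳ (lowerMod (fmap T p)) c x ⟩
        hom TB c (map (fmap T p) x) ∎
        where
          TA = obj T A
          TB = obj T B
          lax : Lax p (idF A) (i₀ M) (i₁ M)
          lax a = ≤-trans (hom-id B (map p a)) (≤-reflexive (sym (M≡p (map p a) a)))
          exact : Exact p (idF A) (i₀ M) (i₁ M)
          exact b a = trans (M≡p b a) (sym (compRaw-identityʳ (lowerMod p) b a))

      Tbar-idMod : ∀ {A} c x → Tbar T (idMod A) c x ≡ hom (obj T A) c x
      Tbar-idMod {A} c x = trans (Tbar-represented (idMod A) (idF A) (λ _ _ → refl) c x)
                                 (cong (hom (obj T A) c) (fmap-id T x))

      Tbar-lowerMod : ∀ {A B} (f : Fun A B) c x → Tbar T (lowerMod f) c x ≡ lower (fmap T f) c x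
      Tbar-lowerMod f = Tbar-represented (lowerMod f) f (λ _ _ → refl)

      Tbar-compMod : ∀ {A B C} (M : Module A B) (N : Module B C) c x →
        Tbar T (compMod N M) c x ≡ compRaw (obj T A) (obj T B) (obj T C) (Tbar T N) (Tbar T M) c x
      Tbar-compMod {A} {B} {C} M N c x = begin
        Tbar T NM c x
          ≡⟨ Tbar-hom NM c x ⟩
        hom (obj T (Coll NM)) (map (fmap T (i₀ NM)) c) (map (fmap T (i₁ NM)) x)
          ≡⟨ sym (fmap-fullyFaithful (collNM→stack-fullyFaithful M N) _ _) ⟩
        hom TS (map T-NM→S (map (fmap T (i₀ NM)) c)) (map T-NM→S (map (fmap T (i₁ NM)) x))
          ≡⟨ cong₂ (hom TS) (fmap-square (λ _ → refl) c) (fmap-square (λ _ → refl) x) ⟩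
        hom TS (map (fmap T (collN→stack M N)) (map (fmap T (i₀ N)) c))
               (map (fmap T (i₁ (stackMod M N))) (map (fmap T (i₁ M)) x))
          ≡⟨ proj₂ (pe (i₁ N) (i₀ M) _ _ (stack-lax M N) (stack-exact M N)) _ _ ⟩
        ⋁ (λ b → hom (obj T (Coll N)) (map (fmap T (i₀ N)) c) (map (fmap T (i₁ N)) b)
               ⊗ hom (obj T (Coll M)) (map (fmap T (i₀ M)) b) (map (fmap T (i₁ M)) x))
          ≡⟨ ⋁-cong (λ b → sym (cong₂ _⊗_ (Tbar-hom N c b) (Tbar-hom M b x))) ⟩
        compRaw (obj T A) (obj T B) (obj T C) (Tbar T N) (Tbar T M) c x ∎
        where
          NM = compMod N M
          TS = obj T (Coll (stackMod M N))
          T-NM→S = fmap T (collNM→stack M N)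

proposition5p7 : (Q : Quantale) → let open Theory Q in
    (T : TwoFunctor) → PreservesExact T →
    (∀ {A B} (M : Module A B) → IsModule (obj T A) (obj T B) (Tbar T M))
    × (∀ {A} c x → Tbar T (idMod A) c x ≡ hom (obj T A) c x)
    × (∀ {A B C} (M : Module A B) (N : Module B C) c x →
    Tbar T (compMod N M) c x ≡ compRaw (obj T A) (obj T B) (obj T C) (Tbar T N) (Tbar T M) c x)
    × (∀ {A B} (M M' : Module A B) → (∀ b a → Module.R M b a ≤ Module.R M' b a) →
    ∀ c x → Tbar T M c x ≤ Tbar T M' c x)
    × (∀ {A B} (f : Fun A B) c x → Tbar T (lowerMod f) c x ≡ lower (fmap T f) c x)
proposition5p7 Q T pe =
    Tbar-isModule Q T
  , Tbar-idMod Q T pe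
  , Tbar-compMod Q T pe
  , Tbar-mono Q T
  , Tbar-lowerMod Q T pe
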